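{- In the single-agent scenario, a social choice function $f:\Theta\rightarrow X$ is strongly implementable if and only if there exists a payment function $P:\Theta\rightarrow\mathbb{Q}$ such that the direct revelation mechanism $\Gamma_{(f,P)}$ is incentive compatible and has no bad equilibria.
   Context: Single-agent scenario: one agent with a finite type set $\Theta$, a finite set $X$ of social choices, and a valuation function $V:X\times\Theta\rightarrow\mathbb{Q}$; a social choice function is $f:\Theta\rightarrow X$. A mechanism $\Gamma=(S,g,P)$ consists of a bid set $S$, an outcome function $g:S\rightarrow X$ and a payment function $P:S\rightarrow\mathbb{Q}$. The utility of the agent of type $\theta$ from bid $s$ is $U^\Gamma(s\mid\theta)=V(g(s),\theta)+P(s)$. A strategy is $\alpha:\Theta\rightarrow S$; it is an equilibrium if $U^\Gamma(\alpha(\theta)\mid\theta)\ge U^\Gamma(\bar s\mid\theta)$ for all $\theta\in\Theta$, $\bar s\in S$. $\Gamma$ strongly implements $f$ if it has at least one equilibrium and every equilibrium $\alpha$ satisfies $g\circ\alpha=f$; $f$ is strongly implementable if some mechanism strongly implements it. The direct revelation mechanism $\Gamma_{(f,P)}$ is $(\Theta,f,P)$ with $P:\Theta\rightarrow\mathbb{Q}$; it is incentive compatible if the identity strategy is an equilibrium; an equilibrium $\alpha$ of $\Gamma_{(f,P)}$ is bad if $f\circ\alpha\neq f$. -}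

module Defs where

open import Data.Nat using (ℕ)
open import Data.Fin using (Fin)
open import Data.Rational using (ℚ; _+_; _≤_)
open import Data.Product using (Σ; _×_)
open import Relation.Binary.PropositionalEquality using (_≡_)
open import Relation.Nullary using (¬_)
open import Function using (_∘_; id)

record Mechanism (nΘ nX : ℕ) : Set₁ where
  field
    S : Set
    g : S → Fin nX
    P : S → ℚ

module _ {nΘ nX : ℕ} (V : Fin nX → Fin nΘ → ℚ) where

  utility : (Γ : Mechanism nΘ nX) → Mechanism.S Γ → Fin nΘ → ℚ
  utility Γ s θ = V (Mechanism.g Γ s) θ + Mechanism.P Γ s

  IsEquilibrium : (Γ : Mechanism nΘ nX) → (Fin nΘ → Mechanism.S Γ) → Set
  IsEquilibrium Γ α = ∀ (θ : Fin nΘ) (s̄ : Mechanism.S Γ) →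
    utility Γ s̄ θ ≤ utility Γ (α θ) θ

  StronglyImplements : Mechanism nΘ nX → (Fin nΘ → Fin nX) → Set
  StronglyImplements Γ f =
    Σ (Fin nΘ → Mechanism.S Γ) (IsEquilibrium Γ)
    × (∀ (α : Fin nΘ → Mechanism.S Γ) → IsEquilibrium Γ α →
         ∀ θ → Mechanism.g Γ (α θ) ≡ f θ)

  StronglyImplementable : (Fin nΘ → Fin nX) → Set₁
  StronglyImplementable f = Σ (Mechanism nΘ nX) (λ Γ → StronglyImplements Γ f)

  direct : (Fin nΘ → Fin nX) → (Fin nΘ → ℚ) → Mechanism nΘ nX
  direct f P = record { S = Fin nΘ ; g = f ; P = P }

  IncentiveCompatible : (Fin nΘ → Fin nX) → (Fin nΘ → ℚ) → Set
  IncentiveCompatible f P = IsEquilibrium (direct f P) id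

  IsBadEquilibrium : (f : Fin nΘ → Fin nX) (P : Fin nΘ → ℚ) → (Fin nΘ → Fin nΘ) → Set
  IsBadEquilibrium f P α = IsEquilibrium (direct f P) α × ¬ (∀ θ → f (α θ) ≡ f θ)

  NoBadEquilibria : (Fin nΘ → Fin nX) → (Fin nΘ → ℚ) → Set
  NoBadEquilibria f P = ∀ (α : Fin nΘ → Fin nΘ) → ¬ IsBadEquilibrium f P α

module Submission where

open import Defs
open import Data.Nat using (ℕ)
open import Data.Fin using (Fin)
open import Data.Fin.Properties using (all?; _≟_)
open import Data.Rational using (ℚ; _+_)
open import Data.Rational.Properties using (module ≤-Reasoning)
open import Data.Product using (Σ; _×_; _,_)
open import Function using (_∘_; id)
open import Function.Bundles using (_⇔_; mk⇔)
open import Relation.Binary.PropositionalEquality using (_≡_; sym; trans; cong)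
open import Relation.Nullary using (¬_)
open import Relation.Nullary.Decidable using (decidable-stable)

-- Forward direction (revelation principle): if α₀ is an equilibrium of Γ realising f,
-- then bidding θ' in the direct mechanism with payments P ∘ α₀ is worth exactly as much
-- as bidding α₀ θ' in Γ.  So the identity is an equilibrium, and any equilibrium β of the
-- direct mechanism lifts to the equilibrium α₀ ∘ β of Γ, which realises f by strong
-- implementation; hence f ∘ β = f.  Backward direction: the direct mechanism itself
-- strongly implements f, since on the finite type set "f ∘ α ≠ f is impossible"
-- yields f ∘ α = f.

module _ {nΘ nX : ℕ} (V : Fin nX → Fin nΘ → ℚ) where

  module Revelation (Γ : Mechanism nΘ nX) (α₀ : Fin nΘ → Mechanism.S Γ)
                    (f : Fin nΘ → Fin nX) (g∘α₀≡f : ∀ θ → Mechanism.g Γ (α₀ θ) ≡ f θ) where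

    open Mechanism Γ
    open ≤-Reasoning

    revealed : Mechanism nΘ nX
    revealed = direct V f (P ∘ α₀)

    utility-revealed : ∀ θ' θ → utility V revealed θ' θ ≡ utility V Γ (α₀ θ') θ
    utility-revealed θ' θ = cong (λ x → V x θ + P (α₀ θ')) (sym (g∘α₀≡f θ'))

    module _ (α₀-equilibrium : IsEquilibrium V Γ α₀) where

      revealed-incentiveCompatible : IncentiveCompatible V f (P ∘ α₀)
      revealed-incentiveCompatible θ θ' = begin
        utility V revealed θ' θ  ≡⟨ utility-revealed θ' θ ⟩
        utility V Γ (α₀ θ') θ    ≤⟨ α₀-equilibrium θ (α₀ θ') ⟩
        utility V Γ (α₀ θ) θ     ≡⟨ utility-revealed θ θ ⟨
        utility V revealed θ θ   ∎

      lift-equilibrium : ∀ β → IsEquilibrium V revealed β → IsEquilibrium V Γ (α₀ ∘ β)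
      lift-equilibrium β β-equilibrium θ s̄ = begin
        utility V Γ s̄ θ               ≤⟨ α₀-equilibrium θ s̄ ⟩
        utility V Γ (α₀ θ) θ          ≡⟨ utility-revealed θ θ ⟨
        utility V revealed θ θ        ≤⟨ β-equilibrium θ θ ⟩
        utility V revealed (β θ) θ    ≡⟨ utility-revealed (β θ) θ ⟩
        utility V Γ (α₀ (β θ)) θ      ∎

  module _ (f : Fin nΘ → Fin nX) where

    revelation-principle : StronglyImplementable V f →
      Σ (Fin nΘ → ℚ) (λ P → IncentiveCompatible V f P × NoBadEquilibria V f P)
    revelation-principle (Γ , (α₀ , α₀-equilibrium) , realises-f) =
      P ∘ α₀ , revealed-incentiveCompatible α₀-equilibrium , noBad
      where
      open Mechanism Γ using (P)
      g∘α₀≡f : ∀ θ → Mechanism.g Γ (α₀ θ) ≡ f θ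
      g∘α₀≡f = realises-f α₀ α₀-equilibrium
      open Revelation Γ α₀ f g∘α₀≡f

      noBad : NoBadEquilibria V f (P ∘ α₀)
      noBad β (β-equilibrium , f∘β≢f) = f∘β≢f λ θ →
        trans (sym (g∘α₀≡f (β θ)))
              (realises-f (α₀ ∘ β) (lift-equilibrium α₀-equilibrium β β-equilibrium) θ)

    pointwise-≡-stable : ∀ (α : Fin nΘ → Fin nΘ) →
      ¬ ¬ (∀ θ → f (α θ) ≡ f θ) → ∀ θ → f (α θ) ≡ f θ
    pointwise-≡-stable α = decidable-stable (all? λ θ → f (α θ) ≟ f θ)

    direct-stronglyImplements : ∀ P → IncentiveCompatible V f P → NoBadEquilibria V f P →
      StronglyImplements V (direct V f P) f
    direct-stronglyImplements P ic noBad =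
      (id , ic) , λ α α-equilibrium →
        pointwise-≡-stable α (λ f∘α≢f → noBad α (α-equilibrium , f∘α≢f))

theorem6 : (nΘ nX : ℕ) (V : Fin nX → Fin nΘ → ℚ) (f : Fin nΘ → Fin nX) →
    StronglyImplementable V f
      ⇔ Σ (Fin nΘ → ℚ) (λ P → IncentiveCompatible V f P × NoBadEquilibria V f P)
theorem6 nΘ nX V f = mk⇔ (revelation-principle V f)
  λ (P , ic , noBad) → direct V f P , direct-stronglyImplements V f P ic noBad
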